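{- $LET_F$-tableaux provide a decision procedure for $LET_F$: for every finite set $\Gamma$ of formulas and every formula $A$, systematically applying the tableau rules to $\{1(B):B\in\Gamma\}\cup\{0(A)\}$ yields, after finitely many steps, a terminated tableau, and this tableau is closed if and only if $\Gamma\vdash A$ (equivalently $\Gamma\models A$); hence the relation $\Gamma\vdash A$ is decidable.
   Context: The language $\mathcal{L}$ of $LET_F$ has propositional letters $p_1,p_2,\dots$, unary connectives $\circ,\bullet,\neg$, binary $\wedge,\vee$. An $LET_F$-valuation is a function $v:\mathcal{L}\to\{0,1\}$ such that for all formulas $A,B$: (v1) $v(A\wedge B)=1$ iff $v(A)=1$ and $v(B)=1$; (v2) $v(A\vee B)=1$ iff $v(A)=1$ or $v(B)=1$; (v3) $v(\neg(A\wedge B))=1$ iff $v(\neg A)=1$ or $v(\neg B)=1$; (v4) $v(\neg(A\vee B))=1$ iff $v(\neg A)=1$ and $v(\neg B)=1$; (v5) $v(A)=1$ iff $v(\neg\neg A)=1$; (v6) if $v(\circ A)=1$ then ($v(A)=1$ iff $v(\neg A)=0$); (v7) $v(\bullet A)=1$ iff $v(\circ A)=0$. $\Gamma\models A$ means: for every $LET_F$-valuation $v$, if $v(B)=1$ for all $B\in\Gamma$ then $v(A)=1$. Tableau rules on signed formulas $1(F)$, $0(F)$ ("$\mid$" = branching): R1: $1(A\wedge B) \Rightarrow 1(A), 1(B)$. R2: $0(A\wedge B) \Rightarrow 0(A) \mid 0(B)$. R3: $1(\neg(A\wedge B)) \Rightarrow 1(\neg A) \mid 1(\neg B)$. R4: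 $0(\neg(A\wedge B)) \Rightarrow 0(\neg A), 0(\neg B)$. R5: $1(A\vee B) \Rightarrow 1(A) \mid 1(B)$. R6: $0(A\vee B) \Rightarrow 0(A), 0(B)$. R7: $1(\neg(A\vee B)) \Rightarrow 1(\neg A), 1(\neg B)$. R8: $0(\neg(A\vee B)) \Rightarrow 0(\neg A) \mid 0(\neg B)$. R9: $1(\neg\neg A) \Rightarrow 1(A)$. R10: $0(\neg\neg A) \Rightarrow 0(A)$. R11: $1(\circ A) \Rightarrow 1(A), 0(\neg A) \mid 0(A), 1(\neg A)$. R12: $1(\bullet A) \Rightarrow 0(\circ A)$. R13: $0(\bullet A) \Rightarrow 1(\circ A)$. No other rules. A tableau for a set $\Delta$ of signed formulas is a tree whose first node contains $\Delta$ and whose further nodes arise by applying rules (each rule applied to a given signed formula at most once per branch). A branch is closed if it contains $1(F)$ and $0(F)$ for some $F$; a tableau is closed if all branches are closed; it is terminated when no rule can be applied on any open branch. $\Gamma\vdash A$ means there is a closed tableau for $\{1(B):B\in\Gamma\}\cup\{0(A)\}$. -}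

module Defs where

open import Data.Nat using (ℕ)
open import Data.Bool using (Bool; true; false)
open import Data.List using (List; []; _∷_; _++_; map)
open import Data.List.Membership.Propositional using (_∈_; _∉_)
open import Data.Product using (Σ; ∃; _×_; _,_)
open import Data.Sum using (_⊎_)
open import Data.Unit using (⊤)
open import Relation.Binary.PropositionalEquality using (_≡_)
open import Function.Bundles using (_⇔_)

infixr 6 _∧'_
infixr 5 _∨'_

data Form : Set where
  var  : ℕ → Form
  ∘'_  : Form → Form
  •'_  : Form → Form
  ¬'_  : Form → Form
  _∧'_ : Form → Form → Form
  _∨'_ : Form → Form → Form

record IsValuation (v : Form → Bool) : Set where
  field
    v1 : ∀ A B → v (A ∧' B) ≡ true ⇔ (v A ≡ true × v B ≡ true)
    v2 : ∀ A B → v (A ∨' B) ≡ true ⇔ (v A ≡ true ⊎ v B ≡ true)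
    v3 : ∀ A B → v (¬' (A ∧' B)) ≡ true ⇔ (v (¬' A) ≡ true ⊎ v (¬' B) ≡ true)
    v4 : ∀ A B → v (¬' (A ∨' B)) ≡ true ⇔ (v (¬' A) ≡ true × v (¬' B) ≡ true)
    v5 : ∀ A → v A ≡ true ⇔ v (¬' ¬' A) ≡ true
    v6 : ∀ A → v (∘' A) ≡ true → (v A ≡ true ⇔ v (¬' A) ≡ false)
    v7 : ∀ A → v (•' A) ≡ true ⇔ v (∘' A) ≡ false

_⊨_ : List Form → Form → Set
Γ ⊨ A = ∀ (v : Form → Bool) → IsValuation v →
        (∀ B → B ∈ Γ → v B ≡ true) → v A ≡ true

data Sign : Set where
  𝟙 𝟘 : Sign

SForm : Set
SForm = Sign × Form

data Out : Set where
  lin : List SForm → Out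
  br  : List SForm → List SForm → Out

data Rule : SForm → Out → Set where
  R1  : ∀ A B → Rule (𝟙 , A ∧' B) (lin ((𝟙 , A) ∷ (𝟙 , B) ∷ []))
  R2  : ∀ A B → Rule (𝟘 , A ∧' B) (br ((𝟘 , A) ∷ []) ((𝟘 , B) ∷ []))
  R3  : ∀ A B → Rule (𝟙 , ¬' (A ∧' B)) (br ((𝟙 , ¬' A) ∷ []) ((𝟙 , ¬' B) ∷ []))
  R4  : ∀ A B → Rule (𝟘 , ¬' (A ∧' B)) (lin ((𝟘 , ¬' A) ∷ (𝟘 , ¬' B) ∷ []))
  R5  : ∀ A B → Rule (𝟙 , A ∨' B) (br ((𝟙 , A) ∷ []) ((𝟙 , B) ∷ []))
  R6  : ∀ A B → Rule (𝟘 , A ∨' B) (lin ((𝟘 , A) ∷ (𝟘 , B) ∷ []))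
  R7  : ∀ A B → Rule (𝟙 , ¬' (A ∨' B)) (lin ((𝟙 , ¬' A) ∷ (𝟙 , ¬' B) ∷ []))
  R8  : ∀ A B → Rule (𝟘 , ¬' (A ∨' B)) (br ((𝟘 , ¬' A) ∷ []) ((𝟘 , ¬' B) ∷ []))
  R9  : ∀ A → Rule (𝟙 , ¬' ¬' A) (lin ((𝟙 , A) ∷ []))
  R10 : ∀ A → Rule (𝟘 , ¬' ¬' A) (lin ((𝟘 , A) ∷ []))
  R11 : ∀ A → Rule (𝟙 , ∘' A) (br ((𝟙 , A) ∷ (𝟘 , ¬' A) ∷ []) ((𝟘 , A) ∷ (𝟙 , ¬' A) ∷ []))
  R12 : ∀ A → Rule (𝟙 , •' A) (lin ((𝟘 , ∘' A) ∷ []))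
  R13 : ∀ A → Rule (𝟘 , •' A) (lin ((𝟙 , ∘' A) ∷ []))

Applicable : SForm → Set
Applicable F = ∃ λ o → Rule F o

-- Tableaux.
-- `Tableau branch used` : a (finite) tableau continuing a branch whose
-- signed formulas so far are `branch`, where the signed formulas in
-- `used` already had their rule applied on this branch (each rule is
-- applied to a given signed formula at most once per branch).

data Tableau (branch : List SForm) (used : List SForm) : Set where
  leaf  : Tableau branch used
  step1 : ∀ F ext → F ∈ branch → F ∉ used → Rule F (lin ext) →
          Tableau (ext ++ branch) (F ∷ used) → Tableau branch used
  step2 : ∀ F ext₁ ext₂ → F ∈ branch → F ∉ used → Rule F (br ext₁ ext₂) →
          Tableau (ext₁ ++ branch) (F ∷ used) →
          Tableau (ext₂ ++ branch) (F ∷ used) → Tableau branch used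

AllBranches : (P : List SForm → List SForm → Set) →
              ∀ {b u} → Tableau b u → Set
AllBranches P {b} {u} leaf = P b u
AllBranches P (step1 F ext _ _ _ t) = AllBranches P t
AllBranches P (step2 F e₁ e₂ _ _ _ t₁ t₂) = AllBranches P t₁ × AllBranches P t₂

BranchClosed : List SForm → Set
BranchClosed b = ∃ λ F → (𝟙 , F) ∈ b × (𝟘 , F) ∈ b

Closed : ∀ {b u} → Tableau b u → Set
Closed = AllBranches (λ b _ → BranchClosed b)

Terminated : ∀ {b u} → Tableau b u → Set
Terminated = AllBranches (λ b u → BranchClosed b ⊎
                                   (∀ F → F ∈ b → Applicable F → F ∈ u))

initial : List Form → Form → List SForm
initial Γ A = (𝟘 , A) ∷ map (λ B → (𝟙 , B)) Γ

TableauFor : List Form → Form → Set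
TableauFor Γ A = Tableau (initial Γ A) []

_⊢_ : List Form → Form → Set
Γ ⊢ A = Σ (TableauFor Γ A) Closed

-- Each rule strictly lowers a weight on signed formulas in which ¬A is
-- measured by the shape of A (so ¬¬A, ¬(A∧B), ¬(A∨B) are heavier than
-- their components), hence rules can be applied exhaustively in finitely
-- many steps. Every rule preserves satisfiability by some LET_F-valuation,
-- so a closed tableau refutes every valuation. Conversely an open saturated
-- branch yields a valuation: atoms, ∘A and the negations ¬p, ¬∘A, ¬•A are
-- read off the branch, all other formulas are evaluated compositionally
-- (with ¬ pushed through ¬, ∧ and ∨), and saturation under R11 gives (v6).
-- So a terminated tableau is closed exactly when Γ ⊨ A, independently of
-- the order in which rules were applied, which also decides Γ ⊢ A.
module Submission where

open import Defs
open import Data.Bool using (Bool; true; false; _∧_; _∨_; not)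
open import Data.Bool.Properties using (not-injective; not-¬; ¬-not)
open import Data.Empty using (⊥-elim)
open import Data.List using (List; []; _∷_; _++_; map)
open import Data.List.Properties using (map-++)
open import Data.Nat.ListAction using (sum)
open import Data.Nat.ListAction.Properties using (sum-++)
open import Data.List.Membership.Propositional using (_∈_; _∉_)
open import Data.List.Membership.Propositional.Properties using (∈-++⁺ˡ; ∈-++⁺ʳ; ∈-++⁻; ∈-map⁺)
open import Data.List.Relation.Binary.Subset.Propositional using (_⊆_)
open import Data.List.Relation.Binary.Subset.Propositional.Properties using (xs⊆xs++ys; xs⊆ys++xs; ++⁺ʳ)
open import Data.List.Relation.Unary.All using (All; []; _∷_; lookup; tabulate)
import Data.List.Relation.Unary.All.Properties as All
open import Data.List.Relation.Unary.Any using (here; there; any?; satisfied)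
import Data.List.Relation.Unary.Any as Any
open import Data.Nat using (ℕ; suc; _+_; _<_; s≤s; s≤s⁻¹; z<s) renaming (_≟_ to _≟ℕ_)
open import Data.Nat.Properties using (+-identityʳ; m≤m+n; m≤n+m; ≤-reflexive; ≤-trans; <-≤-trans; m<n+m; +-monoʳ-≤; +-monoˡ-<; n<1+n)
open import Data.Product using (Σ; _×_; _,_; proj₁; proj₂)
open import Data.Product.Properties using (≡-dec)
open import Data.Sum using (_⊎_; inj₁; inj₂; [_,_])
import Data.Sum as Sum
open import Function using (id; _∘_)
open import Function.Bundles using (_⇔_; mk⇔; module Equivalence)
open Equivalence using (to; from)
import Function.Properties.Equivalence as ⇔
open import Relation.Binary.Definitions using (DecidableEquality)
open import Relation.Binary.PropositionalEquality using (_≡_; refl; sym; trans; cong; cong₂; subst)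
open import Relation.Nullary using (Dec; yes; no; ¬_; does)
open import Relation.Nullary.Decidable using (map′; _×-dec_; dec-true; dec-false)
import Relation.Nullary.Decidable as Dec

_≟ˢ_ : DecidableEquality Sign
𝟙 ≟ˢ 𝟙 = yes refl
𝟙 ≟ˢ 𝟘 = no λ ()
𝟘 ≟ˢ 𝟙 = no λ ()
𝟘 ≟ˢ 𝟘 = yes refl

infix 4 _≟_

_≟_ : DecidableEquality Form
var m ≟ var n = map′ (cong var) (λ { refl → refl }) (m ≟ℕ n)
var _ ≟ ∘' _ = no λ ()
var _ ≟ •' _ = no λ ()
var _ ≟ ¬' _ = no λ ()
var _ ≟ _ ∧' _ = no λ ()
var _ ≟ _ ∨' _ = no λ ()
∘' _ ≟ var _ = no λ ()
∘' A ≟ ∘' B = map′ (cong ∘'_) (λ { refl → refl }) (A ≟ B)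
∘' _ ≟ •' _ = no λ ()
∘' _ ≟ ¬' _ = no λ ()
∘' _ ≟ _ ∧' _ = no λ ()
∘' _ ≟ _ ∨' _ = no λ ()
•' _ ≟ var _ = no λ ()
•' _ ≟ ∘' _ = no λ ()
•' A ≟ •' B = map′ (cong •'_) (λ { refl → refl }) (A ≟ B)
•' _ ≟ ¬' _ = no λ ()
•' _ ≟ _ ∧' _ = no λ ()
•' _ ≟ _ ∨' _ = no λ ()
¬' _ ≟ var _ = no λ ()
¬' _ ≟ ∘' _ = no λ ()
¬' _ ≟ •' _ = no λ ()
¬' A ≟ ¬' B = map′ (cong ¬'_) (λ { refl → refl }) (A ≟ B)
¬' _ ≟ _ ∧' _ = no λ ()
¬' _ ≟ _ ∨' _ = no λ ()
_ ∧' _ ≟ var _ = no λ ()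
_ ∧' _ ≟ ∘' _ = no λ ()
_ ∧' _ ≟ •' _ = no λ ()
_ ∧' _ ≟ ¬' _ = no λ ()
A ∧' B ≟ C ∧' D =
  map′ (λ (p , q) → cong₂ _∧'_ p q) (λ { refl → refl , refl }) (A ≟ C ×-dec B ≟ D)
_ ∧' _ ≟ _ ∨' _ = no λ ()
_ ∨' _ ≟ var _ = no λ ()
_ ∨' _ ≟ ∘' _ = no λ ()
_ ∨' _ ≟ •' _ = no λ ()
_ ∨' _ ≟ ¬' _ = no λ ()
_ ∨' _ ≟ _ ∧' _ = no λ ()
A ∨' B ≟ C ∨' D =
  map′ (λ (p , q) → cong₂ _∨'_ p q) (λ { refl → refl , refl }) (A ≟ C ×-dec B ≟ D)

open import Data.List.Membership.DecPropositional (≡-dec _≟ˢ_ _≟_) using (_∈?_)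

AllExtensions : (List SForm → Set) → Out → Set
AllExtensions P (lin e) = P e
AllExtensions P (br e₁ e₂) = P e₁ × P e₂

SomeExtension : (List SForm → Set) → Out → Set
SomeExtension P (lin e) = P e
SomeExtension P (br e₁ e₂) = P e₁ ⊎ P e₂

allExtensions-map : ∀ {P Q : List SForm → Set} o →
                    (∀ {e} → P e → Q e) → AllExtensions P o → AllExtensions Q o
allExtensions-map (lin e) f p = f p
allExtensions-map (br e₁ e₂) f (p₁ , p₂) = f p₁ , f p₂

someExtension-map : ∀ {P Q : List SForm → Set} o →
                    (∀ {e} → P e → Q e) → SomeExtension P o → SomeExtension Q o
someExtension-map (lin e) f p = f p
someExtension-map (br e₁ e₂) f = Sum.map f f

rule-functional : ∀ {F o₁ o₂} → Rule F o₁ → Rule F o₂ → o₁ ≡ o₂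
rule-functional (R1 _ _) (R1 _ _) = refl
rule-functional (R2 _ _) (R2 _ _) = refl
rule-functional (R3 _ _) (R3 _ _) = refl
rule-functional (R4 _ _) (R4 _ _) = refl
rule-functional (R5 _ _) (R5 _ _) = refl
rule-functional (R6 _ _) (R6 _ _) = refl
rule-functional (R7 _ _) (R7 _ _) = refl
rule-functional (R8 _ _) (R8 _ _) = refl
rule-functional (R9 _) (R9 _) = refl
rule-functional (R10 _) (R10 _) = refl
rule-functional (R11 _) (R11 _) = refl
rule-functional (R12 _) (R12 _) = refl
rule-functional (R13 _) (R13 _) = refl

applicable? : (F : SForm) → Dec (Applicable F)
applicable? (_ , var _) = no λ { (_ , ()) }
applicable? (𝟙 , ∘' A) = yes (_ , R11 A)
applicable? (𝟘 , ∘' _) = no λ { (_ , ()) }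
applicable? (𝟙 , •' A) = yes (_ , R12 A)
applicable? (𝟘 , •' A) = yes (_ , R13 A)
applicable? (𝟙 , A ∧' B) = yes (_ , R1 A B)
applicable? (𝟘 , A ∧' B) = yes (_ , R2 A B)
applicable? (𝟙 , A ∨' B) = yes (_ , R5 A B)
applicable? (𝟘 , A ∨' B) = yes (_ , R6 A B)
applicable? (_ , ¬' var _) = no λ { (_ , ()) }
applicable? (_ , ¬' ∘' _) = no λ { (_ , ()) }
applicable? (_ , ¬' •' _) = no λ { (_ , ()) }
applicable? (𝟙 , ¬' ¬' A) = yes (_ , R9 A)
applicable? (𝟘 , ¬' ¬' A) = yes (_ , R10 A)
applicable? (𝟙 , ¬' (A ∧' B)) = yes (_ , R3 A B)
applicable? (𝟘 , ¬' (A ∧' B)) = yes (_ , R4 A B)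
applicable? (𝟙 , ¬' (A ∨' B)) = yes (_ , R7 A B)
applicable? (𝟘 , ¬' (A ∨' B)) = yes (_ , R8 A B)

-- Termination

size size¬ : Form → ℕ
size (var _) = 1
size (∘' A) = suc (size A + size¬ A)
size (•' A) = suc (suc (size A + size¬ A))
size (¬' A) = size¬ A
size (A ∧' B) = suc (size A + size B)
size (A ∨' B) = suc (size A + size B)
size¬ (var _) = 1
size¬ (∘' _) = 1
size¬ (•' _) = 1
size¬ (¬' A) = suc (size A)
size¬ (A ∧' B) = suc (size¬ A + size¬ B)
size¬ (A ∨' B) = suc (size¬ A + size¬ B)

size¬-positive : ∀ A → 0 < size¬ A
size¬-positive (var _) = z<s
size¬-positive (∘' _) = z<s
size¬-positive (•' _) = z<s
size¬-positive (¬' _) = z<s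
size¬-positive (_ ∧' _) = z<s
size¬-positive (_ ∨' _) = z<s

size-positive : ∀ A → 0 < size A
size-positive (var _) = z<s
size-positive (∘' _) = z<s
size-positive (•' _) = z<s
size-positive (¬' A) = size¬-positive A
size-positive (_ ∧' _) = z<s
size-positive (_ ∨' _) = z<s

sweight : SForm → ℕ
sweight (_ , F) = size F

weight : List SForm → ℕ
weight = sum ∘ map sweight

weight-++ : ∀ e₁ e₂ → weight (e₁ ++ e₂) ≡ weight e₁ + weight e₂
weight-++ e₁ e₂ = trans (cong sum (map-++ sweight e₁ e₂)) (sum-++ (map sweight e₁) _)

private
  single< : ∀ m → m + 0 < suc m
  single< m = s≤s (≤-reflexive (+-identityʳ m))

  pair< : ∀ m n → m + (n + 0) < suc (m + n)
  pair< m n = s≤s (+-monoʳ-≤ m (≤-reflexive (+-identityʳ n)))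

  left< : ∀ m n → m + 0 < suc (m + n)
  left< m n = s≤s (≤-trans (≤-reflexive (+-identityʳ m)) (m≤m+n m n))

  right< : ∀ m n → n + 0 < suc (m + n)
  right< m n = s≤s (≤-trans (≤-reflexive (+-identityʳ n)) (m≤n+m n m))

rule-decreasing : ∀ {F o} → Rule F o → AllExtensions (λ e → weight e < sweight F) o
rule-decreasing (R1 A B) = pair< (size A) (size B)
rule-decreasing (R2 A B) = left< (size A) (size B) , right< (size A) (size B)
rule-decreasing (R3 A B) = left< (size¬ A) (size¬ B) , right< (size¬ A) (size¬ B)
rule-decreasing (R4 A B) = pair< (size¬ A) (size¬ B)
rule-decreasing (R5 A B) = left< (size A) (size B) , right< (size A) (size B)
rule-decreasing (R6 A B) = pair< (size A) (size B)
rule-decreasing (R7 A B) = pair< (size¬ A) (size¬ B)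
rule-decreasing (R8 A B) = left< (size¬ A) (size¬ B) , right< (size¬ A) (size¬ B)
rule-decreasing (R9 A) = single< (size A)
rule-decreasing (R10 A) = single< (size A)
rule-decreasing (R11 A) = pair< (size A) (size¬ A) , pair< (size A) (size¬ A)
rule-decreasing (R12 A) = single< (suc (size A + size¬ A))
rule-decreasing (R13 A) = single< (suc (size A + size¬ A))

Scheduled : (b u todo : List SForm) → Set
Scheduled b u todo = ∀ {F} → F ∈ b → Applicable F → F ∈ u ⊎ F ∈ todo

unschedule : ∀ {F b u todo} → (Applicable F → F ∈ u) →
             Scheduled b u (F ∷ todo) → Scheduled b u todo
unschedule done sched F∈ app with sched F∈ app
... | inj₁ used = inj₁ used
... | inj₂ (here refl) = inj₁ (done app)
... | inj₂ (there pending) = inj₂ pending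

reschedule : ∀ {F b u todo} e → Scheduled b u (F ∷ todo) →
             Scheduled (e ++ b) (F ∷ u) (e ++ todo)
reschedule e sched G∈ app with ∈-++⁻ e G∈
... | inj₁ new = inj₂ (∈-++⁺ˡ new)
... | inj₂ old with sched old app
...   | inj₁ used = inj₁ (there used)
...   | inj₂ (here refl) = inj₁ (here refl)
...   | inj₂ (there pending) = inj₂ (∈-++⁺ʳ e pending)

applyRule : ∀ {F o b u} → F ∈ b → F ∉ u → Rule F o →
            AllExtensions (λ e → Σ (Tableau (e ++ b) (F ∷ u)) Terminated) o →
            Σ (Tableau b u) Terminated
applyRule {o = lin e} F∈ F∉ r (T , t) = step1 _ e F∈ F∉ r T , t
applyRule {o = br e₁ e₂} F∈ F∉ r ((T₁ , t₁) , (T₂ , t₂)) =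
  step2 _ e₁ e₂ F∈ F∉ r T₁ T₂ , t₁ , t₂

weight-after-skip : ∀ {n} F todo → weight (F ∷ todo) < suc n → weight todo < n
weight-after-skip (_ , A) todo lt = <-≤-trans (m<n+m (weight todo) (size-positive A)) (s≤s⁻¹ lt)

weight-after-rule : ∀ {F n} e todo → weight e < sweight F →
                    weight (F ∷ todo) < suc n → weight (e ++ todo) < n
weight-after-rule {n = n} e todo e< lt =
  subst (_< n) (sym (weight-++ e todo)) (<-≤-trans (+-monoˡ-< (weight todo) e<) (s≤s⁻¹ lt))

saturate : ∀ n todo {b u} → weight todo < n → todo ⊆ b → Scheduled b u todo →
           Σ (Tableau b u) Terminated
saturate (suc n) [] _ _ sched = leaf , inj₂ λ _ F∈ app → [ id , (λ ()) ] (sched F∈ app)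
saturate (suc n) (F ∷ todo) lt sub sched with F ∈? _ | applicable? F
... | yes F∈u | _ =
  saturate n todo (weight-after-skip F todo lt) (sub ∘ there) (unschedule (λ _ → F∈u) sched)
... | no _ | no ¬app =
  saturate n todo (weight-after-skip F todo lt) (sub ∘ there) (unschedule (⊥-elim ∘ ¬app) sched)
... | no F∉u | yes (o , r) =
  applyRule (sub (here refl)) F∉u r
    (allExtensions-map o (λ {e} e< → saturate n (e ++ todo) (weight-after-rule {F} e todo e< lt)
                                        (++⁺ʳ e (sub ∘ there)) (reschedule e sched))
                       (rule-decreasing r))

terminated-tableau : ∀ Γ A → Σ (TableauFor Γ A) Terminated
terminated-tableau Γ A = saturate _ (initial Γ A) (n<1+n _) id (λ F∈ _ → inj₂ F∈)

-- Soundness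

∧≡true⇔ : ∀ x y → (x ∧ y ≡ true) ⇔ (x ≡ true × y ≡ true)
∧≡true⇔ true true = mk⇔ (λ _ → refl , refl) (λ _ → refl)
∧≡true⇔ true false = mk⇔ (λ ()) (λ ())
∧≡true⇔ false _ = mk⇔ (λ ()) (λ ())

∨≡true⇔ : ∀ x y → (x ∨ y ≡ true) ⇔ (x ≡ true ⊎ y ≡ true)
∨≡true⇔ true _ = mk⇔ (λ _ → inj₁ refl) (λ _ → refl)
∨≡true⇔ false true = mk⇔ (λ _ → inj₂ refl) (λ _ → refl)
∨≡true⇔ false false = mk⇔ (λ ()) [ (λ ()) , (λ ()) ]

not≡true⇔ : ∀ x → (not x ≡ true) ⇔ (x ≡ false)
not≡true⇔ true = mk⇔ (λ ()) (λ ())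
not≡true⇔ false = mk⇔ (λ _ → refl) (λ _ → refl)

∧≡false⇔ : ∀ x y → (x ∧ y ≡ false) ⇔ (x ≡ false ⊎ y ≡ false)
∧≡false⇔ true true = mk⇔ (λ ()) [ (λ ()) , (λ ()) ]
∧≡false⇔ true false = mk⇔ (λ _ → inj₂ refl) (λ _ → refl)
∧≡false⇔ false _ = mk⇔ (λ _ → inj₁ refl) (λ _ → refl)

∨≡false⇔ : ∀ x y → (x ∨ y ≡ false) ⇔ (x ≡ false × y ≡ false)
∨≡false⇔ true _ = mk⇔ (λ ()) (λ ())
∨≡false⇔ false true = mk⇔ (λ ()) (λ ())
∨≡false⇔ false false = mk⇔ (λ _ → refl , refl) (λ _ → refl)

≡not⇔ : ∀ x y → (x ≡ not y) ⇔ ((x ≡ true × y ≡ false) ⊎ (x ≡ false × y ≡ true))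
≡not⇔ _ true = mk⇔ (λ p → inj₂ (p , refl)) [ (λ ()) ∘ proj₂ , proj₁ ]
≡not⇔ _ false = mk⇔ (λ p → inj₁ (p , refl)) [ proj₁ , (λ ()) ∘ proj₂ ]

≡true-extensional : ∀ {x y} {P : Set} → (x ≡ true ⇔ P) → (y ≡ true ⇔ P) → x ≡ y
≡true-extensional {true} x⇔P y⇔P = sym (from y⇔P (to x⇔P refl))
≡true-extensional {false} {true} x⇔P y⇔P = from x⇔P (to y⇔P refl)
≡true-extensional {false} {false} _ _ = refl

record IsCompositional (v : Form → Bool) : Set where
  field
    v-∧ : ∀ A B → v (A ∧' B) ≡ v A ∧ v B
    v-∨ : ∀ A B → v (A ∨' B) ≡ v A ∨ v B
    v-¬∧ : ∀ A B → v (¬' (A ∧' B)) ≡ v (¬' A) ∨ v (¬' B)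
    v-¬∨ : ∀ A B → v (¬' (A ∨' B)) ≡ v (¬' A) ∧ v (¬' B)
    v-¬¬ : ∀ A → v (¬' ¬' A) ≡ v A
    v-• : ∀ A → v (•' A) ≡ not (v (∘' A))
    v-∘ : ∀ A → v (∘' A) ≡ true → v A ≡ not (v (¬' A))

valuation⇒compositional : ∀ {v} → IsValuation v → IsCompositional v
valuation⇒compositional {v} isV = record
  { v-∧ = λ A B → ≡true-extensional (v1 A B) (∧≡true⇔ (v A) (v B))
  ; v-∨ = λ A B → ≡true-extensional (v2 A B) (∨≡true⇔ (v A) (v B))
  ; v-¬∧ = λ A B → ≡true-extensional (v3 A B) (∨≡true⇔ (v (¬' A)) (v (¬' B)))
  ; v-¬∨ = λ A B → ≡true-extensional (v4 A B) (∧≡true⇔ (v (¬' A)) (v (¬' B)))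
  ; v-¬¬ = λ A → ≡true-extensional (⇔.sym (v5 A)) ⇔.refl
  ; v-• = λ A → ≡true-extensional (v7 A) (not≡true⇔ (v (∘' A)))
  ; v-∘ = λ A h → ≡true-extensional (v6 A h) (not≡true⇔ (v (¬' A)))
  }
  where open IsValuation isV

compositional⇒valuation : ∀ {v} → IsCompositional v → IsValuation v
compositional⇒valuation {v} c = record
  { v1 = λ A B → along (v-∧ A B) (∧≡true⇔ (v A) (v B))
  ; v2 = λ A B → along (v-∨ A B) (∨≡true⇔ (v A) (v B))
  ; v3 = λ A B → along (v-¬∧ A B) (∨≡true⇔ (v (¬' A)) (v (¬' B)))
  ; v4 = λ A B → along (v-¬∨ A B) (∧≡true⇔ (v (¬' A)) (v (¬' B)))
  ; v5 = λ A → along (sym (v-¬¬ A)) ⇔.refl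
  ; v6 = λ A h → along (v-∘ A h) (not≡true⇔ (v (¬' A)))
  ; v7 = λ A → along (v-• A) (not≡true⇔ (v (∘' A)))
  }
  where
  open IsCompositional c
  along : ∀ {x y} {P : Set} → x ≡ y → (y ≡ true ⇔ P) → (x ≡ true ⇔ P)
  along refl = id

value : Sign → Bool
value 𝟙 = true
value 𝟘 = false

Holds : (Form → Bool) → SForm → Set
Holds v (s , F) = v F ≡ value s

module _ {v : Form → Bool} (c : IsCompositional v) where
  open IsCompositional c

  private
    both : ∀ {F G} → Holds v F × Holds v G → All (Holds v) (F ∷ G ∷ [])
    both (p , q) = p ∷ q ∷ []

    either : ∀ {F G} → Holds v F ⊎ Holds v G → All (Holds v) (F ∷ []) ⊎ All (Holds v) (G ∷ [])
    either = Sum.map (_∷ []) (_∷ [])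

  rule-sound : ∀ {F o} → Rule F o → Holds v F → SomeExtension (All (Holds v)) o
  rule-sound (R1 A B) h = both (to (∧≡true⇔ (v A) (v B)) (trans (sym (v-∧ A B)) h))
  rule-sound (R2 A B) h = either (to (∧≡false⇔ (v A) (v B)) (trans (sym (v-∧ A B)) h))
  rule-sound (R3 A B) h = either (to (∨≡true⇔ (v (¬' A)) (v (¬' B))) (trans (sym (v-¬∧ A B)) h))
  rule-sound (R4 A B) h = both (to (∨≡false⇔ (v (¬' A)) (v (¬' B))) (trans (sym (v-¬∧ A B)) h))
  rule-sound (R5 A B) h = either (to (∨≡true⇔ (v A) (v B)) (trans (sym (v-∨ A B)) h))
  rule-sound (R6 A B) h = both (to (∨≡false⇔ (v A) (v B)) (trans (sym (v-∨ A B)) h))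
  rule-sound (R7 A B) h = both (to (∧≡true⇔ (v (¬' A)) (v (¬' B))) (trans (sym (v-¬∨ A B)) h))
  rule-sound (R8 A B) h = either (to (∧≡false⇔ (v (¬' A)) (v (¬' B))) (trans (sym (v-¬∨ A B)) h))
  rule-sound (R9 A) h = trans (sym (v-¬¬ A)) h ∷ []
  rule-sound (R10 A) h = trans (sym (v-¬¬ A)) h ∷ []
  rule-sound (R11 A) h = Sum.map both both (to (≡not⇔ (v A) (v (¬' A))) (v-∘ A h))
  rule-sound (R12 A) h = to (not≡true⇔ (v (∘' A))) (trans (sym (v-• A)) h) ∷ []
  rule-sound (R13 A) h = not-injective (trans (sym (v-• A)) h) ∷ []

  closed⇒unsatisfied : ∀ {b u} (T : Tableau b u) → Closed T → ¬ All (Holds v) b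
  closed⇒unsatisfied leaf (F , p , q) hb = not-¬ (lookup hb p) (lookup hb q)
  closed⇒unsatisfied (step1 _ _ F∈ _ r T) c hb =
    closed⇒unsatisfied T c (All.++⁺ (rule-sound r (lookup hb F∈)) hb)
  closed⇒unsatisfied (step2 _ _ _ F∈ _ r T₁ T₂) (c₁ , c₂) hb with rule-sound r (lookup hb F∈)
  ... | inj₁ h₁ = closed⇒unsatisfied T₁ c₁ (All.++⁺ h₁ hb)
  ... | inj₂ h₂ = closed⇒unsatisfied T₂ c₂ (All.++⁺ h₂ hb)

⊢⇒⊨ : ∀ {Γ A} → Γ ⊢ A → Γ ⊨ A
⊢⇒⊨ {Γ} (T , c) v isV hΓ =
  ¬-not λ vA≡false → closed⇒unsatisfied (valuation⇒compositional isV) T c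
                       (vA≡false ∷ All.map⁺ (tabulate (hΓ _)))

-- Completeness

Fulfilled : List SForm → SForm → Set
Fulfilled b F = ∀ {o} → Rule F o → SomeExtension (_⊆ b) o

fulfilled-by : ∀ {b F o} → Rule F o → SomeExtension (_⊆ b) o → Fulfilled b F
fulfilled-by {b} r ext r′ = subst (SomeExtension (_⊆ b)) (rule-functional r r′) ext

fulfilled-mono : ∀ {b b′ F} → b ⊆ b′ → Fulfilled b F → Fulfilled b′ F
fulfilled-mono {b} {b′} b⊆b′ ful {o} r =
  someExtension-map {_⊆ b} {_⊆ b′} o (λ e⊆b → b⊆b′ ∘ e⊆b) (ful r)

Saturated : List SForm → Set
Saturated b = ∀ {F} → F ∈ b → Fulfilled b F

UsedFulfilled : List SForm → List SForm → Set
UsedFulfilled b u = ∀ {F} → F ∈ u → Fulfilled b F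

usedFulfilled-step : ∀ {F o b u} e → Rule F o → SomeExtension (_⊆ e ++ b) o →
                     UsedFulfilled b u → UsedFulfilled (e ++ b) (F ∷ u)
usedFulfilled-step e r ext _ (here refl) = fulfilled-by r ext
usedFulfilled-step e r ext ful (there G∈) = fulfilled-mono (xs⊆ys++xs _ e) (ful G∈)

record OpenSaturatedExtension (b₀ : List SForm) : Set where
  field
    branch : List SForm
    extends : b₀ ⊆ branch
    open-branch : ¬ BranchClosed branch
    saturated : Saturated branch

widen : ∀ {b₀ b₁} → b₀ ⊆ b₁ → OpenSaturatedExtension b₁ → OpenSaturatedExtension b₀
widen b₀⊆b₁ ext = record
  { branch = branch ; extends = extends ∘ b₀⊆b₁ ; open-branch = open-branch ; saturated = saturated }
  where open OpenSaturatedExtension ext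

branchClosed? : (b : List SForm) → Dec (BranchClosed b)
branchClosed? b = map′ (λ a → let (G , p) = satisfied a in proj₂ G , p)
                       (λ (F , p , q) → Any.map (λ { refl → p , q }) p)
                       (any? (λ G → (𝟙 , proj₂ G) ∈? b ×-dec (𝟘 , proj₂ G) ∈? b) b)

allBranches? : ∀ {P : List SForm → List SForm → Set} → (∀ b u → Dec (P b u)) →
               ∀ {b u} (T : Tableau b u) → Dec (AllBranches P T)
allBranches? P? {b} {u} leaf = P? b u
allBranches? P? (step1 _ _ _ _ _ T) = allBranches? P? T
allBranches? P? (step2 _ _ _ _ _ _ T₁ T₂) = allBranches? P? T₁ ×-dec allBranches? P? T₂

closed? : ∀ {b u} (T : Tableau b u) → Dec (Closed T)
closed? = allBranches? (λ b _ → branchClosed? b)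

closed-or-open : ∀ {b u} (T : Tableau b u) → UsedFulfilled b u → Terminated T →
                 Closed T ⊎ OpenSaturatedExtension b
closed-or-open leaf _ (inj₁ closed) = inj₁ closed
closed-or-open {b} leaf ful (inj₂ used) with branchClosed? b
... | yes closed = inj₁ closed
... | no open-b = inj₂ record
  { branch = b ; extends = id ; open-branch = open-b
  ; saturated = λ F∈ r → ful (used _ F∈ (_ , r)) r }
closed-or-open (step1 _ e _ _ r T) ful t =
  Sum.map₂ (widen (xs⊆ys++xs _ e))
           (closed-or-open T (usedFulfilled-step e r (xs⊆xs++ys e _) ful) t)
closed-or-open (step2 _ e₁ e₂ _ _ r T₁ T₂) ful (t₁ , t₂)
  with closed-or-open T₁ (usedFulfilled-step e₁ r (inj₁ (xs⊆xs++ys e₁ _)) ful) t₁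
     | closed-or-open T₂ (usedFulfilled-step e₂ r (inj₂ (xs⊆xs++ys e₂ _)) ful) t₂
... | inj₁ c₁ | inj₁ c₂ = inj₁ (c₁ , c₂)
... | inj₂ o₁ | _ = inj₂ (widen (xs⊆ys++xs _ e₁) o₁)
... | inj₁ _ | inj₂ o₂ = inj₂ (widen (xs⊆ys++xs _ e₂) o₂)

module Countermodel {b : List SForm} (open-b : ¬ BranchClosed b) (sat : Saturated b) where

  onBranch : SForm → Bool
  onBranch F = does (F ∈? b)

  onBranch-sound : ∀ {F} → onBranch F ≡ true → F ∈ b
  onBranch-sound {F} h with F ∈? b
  ... | yes F∈ = F∈

  marked : ∀ {A} → (𝟙 , A) ∈ b → onBranch (𝟙 , A) ≡ true
  marked {A} = dec-true ((𝟙 , A) ∈? b)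

  unmarked : ∀ {A} → (𝟘 , A) ∈ b → onBranch (𝟙 , A) ≡ false
  unmarked {A} h = dec-false ((𝟙 , A) ∈? b) (λ h₁ → open-b (A , h₁ , h))

  v v¬ : Form → Bool
  v (var n) = onBranch (𝟙 , var n)
  v (∘' A) = onBranch (𝟙 , ∘' A)
  v (•' A) = not (onBranch (𝟙 , ∘' A))
  v (¬' A) = v¬ A
  v (A ∧' B) = v A ∧ v B
  v (A ∨' B) = v A ∨ v B
  v¬ (var n) = onBranch (𝟙 , ¬' var n)
  v¬ (∘' A) = onBranch (𝟙 , ¬' ∘' A)
  v¬ (•' A) = onBranch (𝟙 , ¬' •' A)
  v¬ (¬' A) = v A
  v¬ (A ∧' B) = v¬ A ∨ v¬ B
  v¬ (A ∨' B) = v¬ A ∧ v¬ B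

  first : ∀ {F e} → (F ∷ e) ⊆ b → F ∈ b
  first e⊆b = e⊆b (here refl)

  second : ∀ {F G e} → (F ∷ G ∷ e) ⊆ b → G ∈ b
  second e⊆b = e⊆b (there (here refl))

  agrees : ∀ {s} A → (s , A) ∈ b → v A ≡ value s
  agrees¬ : ∀ {s} A → (s , ¬' A) ∈ b → v¬ A ≡ value s

  agrees {𝟙} (var _) h = marked h
  agrees {𝟘} (var _) h = unmarked h
  agrees {𝟙} (∘' _) h = marked h
  agrees {𝟘} (∘' _) h = unmarked h
  agrees {𝟙} (•' A) h = cong not (unmarked (first (sat h (R12 A))))
  agrees {𝟘} (•' A) h = cong not (marked (first (sat h (R13 A))))
  agrees (¬' A) h = agrees¬ A h
  agrees {𝟙} (A ∧' B) h =
    let e = sat h (R1 A B) in cong₂ _∧_ (agrees A (first e)) (agrees B (second e))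
  agrees {𝟘} (A ∧' B) h =
    from (∧≡false⇔ (v A) (v B)) (Sum.map (agrees A ∘ first) (agrees B ∘ first) (sat h (R2 A B)))
  agrees {𝟙} (A ∨' B) h =
    from (∨≡true⇔ (v A) (v B)) (Sum.map (agrees A ∘ first) (agrees B ∘ first) (sat h (R5 A B)))
  agrees {𝟘} (A ∨' B) h =
    let e = sat h (R6 A B) in cong₂ _∨_ (agrees A (first e)) (agrees B (second e))

  agrees¬ {𝟙} (var _) h = marked h
  agrees¬ {𝟘} (var _) h = unmarked h
  agrees¬ {𝟙} (∘' _) h = marked h
  agrees¬ {𝟘} (∘' _) h = unmarked h
  agrees¬ {𝟙} (•' _) h = marked h
  agrees¬ {𝟘} (•' _) h = unmarked h
  agrees¬ {𝟙} (¬' A) h = agrees A (first (sat h (R9 A)))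
  agrees¬ {𝟘} (¬' A) h = agrees A (first (sat h (R10 A)))
  agrees¬ {𝟙} (A ∧' B) h =
    from (∨≡true⇔ (v¬ A) (v¬ B)) (Sum.map (agrees¬ A ∘ first) (agrees¬ B ∘ first) (sat h (R3 A B)))
  agrees¬ {𝟘} (A ∧' B) h =
    let e = sat h (R4 A B) in cong₂ _∨_ (agrees¬ A (first e)) (agrees¬ B (second e))
  agrees¬ {𝟙} (A ∨' B) h =
    let e = sat h (R7 A B) in cong₂ _∧_ (agrees¬ A (first e)) (agrees¬ B (second e))
  agrees¬ {𝟘} (A ∨' B) h =
    from (∧≡false⇔ (v¬ A) (v¬ B)) (Sum.map (agrees¬ A ∘ first) (agrees¬ B ∘ first) (sat h (R8 A B)))

  ∘-consistent : ∀ A → v (∘' A) ≡ true → v A ≡ not (v¬ A)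
  ∘-consistent A h =
    from (≡not⇔ (v A) (v¬ A)) (Sum.map agree₂ agree₂ (sat (onBranch-sound h) (R11 A)))
    where
    agree₂ : ∀ {s t e} → ((s , A) ∷ (t , ¬' A) ∷ e) ⊆ b → v A ≡ value s × v¬ A ≡ value t
    agree₂ e = agrees A (first e) , agrees¬ A (second e)

  isValuation : IsValuation v
  isValuation = compositional⇒valuation record
    { v-∧ = λ _ _ → refl ; v-∨ = λ _ _ → refl ; v-¬∧ = λ _ _ → refl ; v-¬∨ = λ _ _ → refl
    ; v-¬¬ = λ _ → refl ; v-• = λ _ → refl ; v-∘ = ∘-consistent }

⊨⇒¬openSaturated : ∀ {Γ A} → Γ ⊨ A → ¬ OpenSaturatedExtension (initial Γ A)
⊨⇒¬openSaturated {Γ} {A} ent ext =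
  not-¬ (ent v isValuation (λ B B∈ → agrees B (extends (there (∈-map⁺ (𝟙 ,_) B∈)))))
        (agrees A (extends (here refl)))
  where
  open OpenSaturatedExtension ext
  open Countermodel open-branch saturated

⊨⇒closed : ∀ {Γ A} → Γ ⊨ A → (T : TableauFor Γ A) → Terminated T → Closed T
⊨⇒closed ent T t = [ id , ⊥-elim ∘ ⊨⇒¬openSaturated ent ] (closed-or-open T (λ ()) t)

theorem16 : (Γ : List Form) (A : Form) →
    Σ (TableauFor Γ A) Terminated
    × (∀ (T : TableauFor Γ A) → Terminated T → (Closed T ⇔ (Γ ⊢ A)))
    × ((Γ ⊢ A) ⇔ (Γ ⊨ A))
    × Dec (Γ ⊢ A)
theorem16 Γ A = (T , t) , closed⇔⊢ , mk⇔ ⊢⇒⊨ ⊨⇒⊢ , Dec.map (closed⇔⊢ T t) (closed? T)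
  where
  T : TableauFor Γ A
  T = proj₁ (terminated-tableau Γ A)
  t : Terminated T
  t = proj₂ (terminated-tableau Γ A)
  closed⇔⊢ : ∀ (T : TableauFor Γ A) → Terminated T → (Closed T ⇔ (Γ ⊢ A))
  closed⇔⊢ T t = mk⇔ (T ,_) (λ d → ⊨⇒closed (⊢⇒⊨ d) T t)
  ⊨⇒⊢ : Γ ⊨ A → Γ ⊢ A
  ⊨⇒⊢ ent = T , ⊨⇒closed ent T t
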